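{- Let $\mathsf{L}\in\{\mathsf{InqL},\mathbf{PT}\}$ and let $X$ be a nonempty team on a finite set $\{p_1,\dots,p_n\}$ of propositional variables. Then the formula $\Theta_X=\neg\neg\bigvee_{v\in X}(p_1^{v(p_1)}\wedge\dots\wedge p_n^{v(p_n)})$ is $\mathcal{F}$-projective in $\mathsf{L}$, where $\mathcal{F}$ is the class of all flat substitutions.
   Context: A valuation is a function $v:\mathrm{Prop}\to\{0,1\}$; a team is a set of valuations; a team on $V$ is a set of functions $V\to\{0,1\}$. $p^1:=p$, $p^0:=\neg p$. Formulas of $\mathbf{PT}$: $\phi::=p\mid\bot\mid\top\mid {=}(\phi,\dots,\phi,\phi)\mid\neg\phi\mid\phi\wedge\phi\mid\phi\otimes\phi\mid\phi\vee\phi\mid\phi\to\phi$; formulas of $\mathsf{InqL}$ are built from $p,\bot,\top$ using $\wedge,\vee,\to$ with $\neg\phi:=\phi\to\bot$. Team semantics: $X\models p$ iff $v(p)=1$ for all $v\in X$; $X\models\bot$ iff $X=\emptyset$; $X\models\top$ always; $X\models\phi\wedge\psi$ iff both; $X\models\phi\otimes\psi$ iff $X=Y\cup Z$ for some $Y,Z\subseteq X$ with $Y\models\phi$, $Z\models\psi$; $X\models\phi\vee\psi$ iff $X\models\phi$ or $X\models\psi$; $X\models\phi\to\psi$ iff every $Y\subseteq X$ with $Y\models\phi$ satisfies $Y\models\psi$; $X\models\neg\phi$ iff $\{v\}\not\models\phi$ for all $v\in X$; $X\models{=}(\phi_1,\dots,\phi_n,\psi)$ iff $X\models\bigwedge_i(\phi_i\vee\neg\phi_i)\to(\psi\vee\neg\psi)$.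 $\Gamma\vdash_{\mathsf{L}}\phi$ iff all formulas are in the language of $\mathsf{L}$ and every team satisfying all of $\Gamma$ satisfies $\phi$. A formula is flat if $X\models\phi$ iff $\{v\}\models\phi$ for all $v\in X$, for every team $X$. A substitution of $\mathsf{L}$ is a map on formulas of $\mathsf{L}$ commuting with all connectives and atoms; flat if each $\sigma(p)$ is flat. For a set $\mathcal{S}$ of substitutions, a formula $\phi$ is $\mathcal{S}$-projective in $\mathsf{L}$ if there is $\sigma\in\mathcal{S}$ with $\vdash_{\mathsf{L}}\sigma(\phi)$ and, for every propositional variable $p$, $\phi,\sigma(p)\vdash_{\mathsf{L}}p$ and $\phi,p\vdash_{\mathsf{L}}\sigma(p)$. -}

module Defs where

open import Level using (Level; Lift; lift) renaming (suc to lsuc; zero to lzero)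
open import Data.Nat using (ℕ)
open import Data.Bool using (Bool; true; false)
open import Data.Fin using (Fin)
open import Data.Unit using (⊤; tt)
open import Data.Empty using (⊥)
open import Data.Product using (Σ; _×_; _,_)
open import Data.Sum using (_⊎_)
open import Data.List using (List; []; _∷_; tabulate)
open import Data.List.NonEmpty using (List⁺; _∷_)
import Data.List.NonEmpty as L⁺
open import Data.List.Relation.Unary.All using (All)
open import Relation.Nullary using (¬_)
open import Relation.Binary.PropositionalEquality using (_≡_)

Val : Set
Val = ℕ → Bool

Team : Set₁
Team = Val → Set

_⊆ₜ_ : Team → Team → Set
Y ⊆ₜ X = ∀ v → Y v → X v

single : Val → Team
single v w = w ≡ v

-- Syntax of PT (InqL is the fragment without ¬, ⊗, dependence atoms;
-- in InqL, ¬φ abbreviates φ → ⊥).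

infixr 6 _∧'_
infixr 5 _∨'_ _⊗_
infixr 4 _⇒_

data Form : Set where
  var  : ℕ → Form
  ⊥'   : Form
  ⊤'   : Form
  dep  : List Form → Form → Form
  ¬'   : Form → Form
  _∧'_ : Form → Form → Form
  _⊗_  : Form → Form → Form
  _∨'_ : Form → Form → Form
  _⇒_  : Form → Form → Form

mutual
  infix 3 _⊨_
  _⊨_ : Team → Form → Set₁
  X ⊨ var p = Lift (lsuc lzero) (∀ v → X v → v p ≡ true)
  X ⊨ ⊥' = Lift (lsuc lzero) (∀ v → ¬ X v)
  X ⊨ ⊤' = Lift (lsuc lzero) ⊤
  X ⊨ dep φs ψ =
    ∀ (Y : Team) → Y ⊆ₜ X → decAll Y φs →
      (Y ⊨ ψ) ⊎ (∀ v → Y v → ¬ (single v ⊨ ψ))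
  X ⊨ ¬' φ = ∀ v → X v → ¬ (single v ⊨ φ)
  X ⊨ (φ ∧' ψ) = (X ⊨ φ) × (X ⊨ ψ)
  X ⊨ (φ ⊗ ψ) =
    Σ Team λ Y → Σ Team λ Z →
      Y ⊆ₜ X × Z ⊆ₜ X × (∀ v → X v → Y v ⊎ Z v) × (Y ⊨ φ) × (Z ⊨ ψ)
  X ⊨ (φ ∨' ψ) = (X ⊨ φ) ⊎ (X ⊨ ψ)
  X ⊨ (φ ⇒ ψ) = ∀ (Y : Team) → Y ⊆ₜ X → (Y ⊨ φ) → (Y ⊨ ψ)

  -- Y ⊨ ⋀ᵢ (φᵢ ∨ ¬φᵢ)   (¬ the flat PT negation, unfolded)
  decAll : Team → List Form → Set₁
  decAll Y [] = Lift (lsuc lzero) ⊤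
  decAll Y (φ ∷ φs) = ((Y ⊨ φ) ⊎ (∀ v → Y v → ¬ (single v ⊨ φ))) × decAll Y φs

data Logic : Set where
  InqL PT : Logic

mutual
  InLang : Logic → Form → Set
  InLang PT _ = ⊤
  InLang InqL (var _) = ⊤
  InLang InqL ⊥' = ⊤
  InLang InqL ⊤' = ⊤
  InLang InqL (dep _ _) = ⊥
  InLang InqL (¬' _) = ⊥
  InLang InqL (φ ∧' ψ) = InLang InqL φ × InLang InqL ψ
  InLang InqL (φ ⊗ ψ) = ⊥
  InLang InqL (φ ∨' ψ) = InLang InqL φ × InLang InqL ψ
  InLang InqL (φ ⇒ ψ) = InLang InqL φ × InLang InqL ψ

neg : Logic → Form → Form
neg InqL φ = φ ⇒ ⊥'
neg PT φ = ¬' φ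

_⊢[_]_ : List Form → Logic → Form → Set₁
Γ ⊢[ L ] φ =
  All (InLang L) Γ × InLang L φ ×
  (∀ (X : Team) → All (λ γ → X ⊨ γ) Γ → X ⊨ φ)

Flat : Form → Set₁
Flat φ = ∀ (X : Team) →
  ((X ⊨ φ) → (∀ v → X v → single v ⊨ φ)) ×
  ((∀ v → X v → single v ⊨ φ) → (X ⊨ φ))

-- A substitution commuting with all connectives and atoms is
-- determined by its values on propositional variables.
Subst : Set
Subst = ℕ → Form

mutual
  subst : Subst → Form → Form
  subst σ (var p) = σ p
  subst σ ⊥' = ⊥'
  subst σ ⊤' = ⊤'
  subst σ (dep φs ψ) = dep (substs σ φs) (subst σ ψ)
  subst σ (¬' φ) = ¬' (subst σ φ)
  subst σ (φ ∧' ψ) = subst σ φ ∧' subst σ ψ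
  subst σ (φ ⊗ ψ) = subst σ φ ⊗ subst σ ψ
  subst σ (φ ∨' ψ) = subst σ φ ∨' subst σ ψ
  subst σ (φ ⇒ ψ) = subst σ φ ⇒ subst σ ψ

  substs : Subst → List Form → List Form
  substs σ [] = []
  substs σ (φ ∷ φs) = subst σ φ ∷ substs σ φs

IsSubstOf : Logic → Subst → Set
IsSubstOf L σ = ∀ p → InLang L (σ p)

FlatSubst : Subst → Set₁
FlatSubst σ = ∀ p → Flat (σ p)

FProjective : Logic → Form → Set₁
FProjective L φ =
  Σ Subst λ σ →
    IsSubstOf L σ × FlatSubst σ ×
    ([] ⊢[ L ] subst σ φ) ×
    (∀ p → (φ ∷ σ p ∷ []) ⊢[ L ] var p) ×
    (∀ p → (φ ∷ var p ∷ []) ⊢[ L ] σ p)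

lit : Logic → ℕ → Bool → Form
lit L p true = var p
lit L p false = neg L (var p)

conj : List Form → Form
conj [] = ⊤'
conj (φ ∷ []) = φ
conj (φ ∷ ψ ∷ ψs) = φ ∧' conj (ψ ∷ ψs)

disj : List⁺ Form → Form
disj (φ ∷ φs) = go φ φs
  where
  go : Form → List Form → Form
  go φ [] = φ
  go φ (ψ ∷ ψs) = φ ∨' go ψ ψs

row : Logic → {n : ℕ} → (Fin n → ℕ) → (Fin n → Bool) → Form
row L ps v = conj (tabulate (λ i → lit L (ps i) (v i)))

Θ : Logic → {n : ℕ} → (Fin n → ℕ) → List⁺ (Fin n → Bool) → Form
Θ L ps X = neg L (neg L (disj (L⁺.map (row L ps) X)))

-- A nonempty team X on p₁ … pₙ is the set of models of Θ_X, and Θ_X is flat: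
-- the double negation turns the disjunction of rows into the condition
-- "u restricted to p₁ … pₙ is a row of X".  Retract every valuation u onto
-- X by keeping u if it lies in X and otherwise jumping to a fixed w ∈ X.
-- The flat substitution σ(p) = (Θ_X → p) ∧ (¬Θ_X → w(p)), with w(p) read
-- as ⊤ or ⊥, is true at u exactly when p is true at the retract of u.  Hence
-- σ(Θ_X) holds everywhere, since the retract always lies in X, while under
-- Θ_X the retract is the identity, so σ(p) and p agree.
module Submission where

open import Defs
open import Data.Nat using (ℕ)
open import Data.Bool using (Bool)
open import Data.Fin using (Fin)
open import Data.List.NonEmpty using (List⁺)
open import Relation.Binary.PropositionalEquality using (_≡_)
open import Function.Definitions using (Injective)

open import Level using (lift; lower)
open import Data.Bool using (true; false) renaming (_≟_ to _≟ᵇ_)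
open import Data.Bool.Properties using (¬-not; not-¬)
import Data.Nat as ℕ
open import Data.Unit using (tt)
open import Data.Empty using (⊥-elim)
open import Data.Product using (_×_; _,_; proj₁; proj₂)
open import Data.Sum using (inj₁; inj₂)
open import Data.List using (List; []; _∷_; map; tabulate)
open import Data.List.NonEmpty using (_∷_; toList)
import Data.List.NonEmpty as List⁺
open import Data.List.Properties using (map-tabulate; tabulate-cong)
import Data.List.NonEmpty.Properties as List⁺
open import Data.List.Relation.Unary.All using (All; []; _∷_; universal)
import Data.List.Relation.Unary.All.Properties as All
open import Data.List.Relation.Unary.Any using (Any; here; there; any?)
import Data.List.Relation.Unary.Any as Any
import Data.List.Relation.Unary.Any.Properties as Any
open import Data.Fin.Properties using (all?) renaming (any? to ∃?)
open import Function using (_∘_; id; case_of_)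
open import Function.Bundles using (_⇔_; mk⇔; Equivalence)
open import Relation.Nullary using (¬_; Dec; yes; no)
open import Relation.Nullary.Decidable using (decidable-stable)
open import Relation.Binary.PropositionalEquality
  using (refl; sym; trans; cong; cong₂; module ≡-Reasoning) renaming (subst to subst≡)

open Equivalence using (to; from)
open ≡-Reasoning

single-⊆ : ∀ {X : Team} {u} → X u → single u ⊆ₜ X
single-⊆ xu v refl = xu

neg-elim : ∀ L {X : Team} {φ} → X ⊨ neg L φ → ∀ u → X u → ¬ (single u ⊨ φ)
neg-elim PT h = h
neg-elim InqL h u xu s = lower (h (single u) (single-⊆ xu) s) u refl

neg-intro : ∀ L {X : Team} {φ} →
            (∀ Y → Y ⊆ₜ X → Y ⊨ φ → ∀ u → ¬ Y u) → X ⊨ neg L φ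
neg-intro PT h u xu s = h (single u) (single-⊆ xu) s u refl
neg-intro InqL h Y Y⊆X s = lift (h Y Y⊆X s)

record Expresses (φ : Form) (P : Val → Set) : Set₁ where
  field
    ⊨⇒∀ : ∀ {X} → X ⊨ φ → ∀ u → X u → P u
    ∀⇒⊨ : ∀ {X} → (∀ u → X u → P u) → X ⊨ φ
open Expresses

module _ {φ : Form} {P : Val → Set} (φ⇔P : Expresses φ P) where

  single-⊨ : ∀ u → (single u ⊨ φ) ⇔ P u
  single-⊨ u = mk⇔ (λ s → φ⇔P .⊨⇒∀ s u refl) (λ pu → φ⇔P .∀⇒⊨ λ { v refl → pu })

  expresses⇒flat : Flat φ
  expresses⇒flat X =
    (λ h u xu → single-⊨ u .from (φ⇔P .⊨⇒∀ h u xu)) ,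
    (λ h → φ⇔P .∀⇒⊨ λ u xu → single-⊨ u .to (h u xu))

  expresses-resp : {Q : Val → Set} → (∀ u → P u ⇔ Q u) → Expresses φ Q
  expresses-resp P⇔Q .⊨⇒∀ h u xu = P⇔Q u .to (φ⇔P .⊨⇒∀ h u xu)
  expresses-resp P⇔Q .∀⇒⊨ h = φ⇔P .∀⇒⊨ λ u xu → P⇔Q u .from (h u xu)

var-expresses : ∀ p → Expresses (var p) (λ u → u p ≡ true)
var-expresses p .⊨⇒∀ = lower
var-expresses p .∀⇒⊨ = lift

const : Bool → Form
const true = ⊤'
const false = ⊥'

const-expresses : ∀ b → Expresses (const b) (λ _ → b ≡ true)
const-expresses true .⊨⇒∀ _ _ _ = refl
const-expresses true .∀⇒⊨ _ = lift tt
const-expresses false .⊨⇒∀ h u xu = ⊥-elim (lower h u xu)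
const-expresses false .∀⇒⊨ h = lift λ u xu → case h u xu of λ ()

∧-expresses : ∀ {φ ψ : Form} {P Q : Val → Set} → Expresses φ P → Expresses ψ Q →
              Expresses (φ ∧' ψ) (λ u → P u × Q u)
∧-expresses φ⇔P ψ⇔Q .⊨⇒∀ (h , k) u xu = φ⇔P .⊨⇒∀ h u xu , ψ⇔Q .⊨⇒∀ k u xu
∧-expresses φ⇔P ψ⇔Q .∀⇒⊨ h = φ⇔P .∀⇒⊨ (λ u → proj₁ ∘ h u) , ψ⇔Q .∀⇒⊨ (λ u → proj₂ ∘ h u)

⇒-expresses : ∀ {φ ψ : Form} {P Q : Val → Set} → Expresses φ P → Expresses ψ Q →
              Expresses (φ ⇒ ψ) (λ u → P u → Q u)
⇒-expresses φ⇔P ψ⇔Q .⊨⇒∀ h u xu pu =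
  single-⊨ ψ⇔Q u .to (h (single u) (single-⊆ xu) (single-⊨ φ⇔P u .from pu))
⇒-expresses φ⇔P ψ⇔Q .∀⇒⊨ h Y Y⊆X yφ =
  ψ⇔Q .∀⇒⊨ λ u yu → h u (Y⊆X u yu) (φ⇔P .⊨⇒∀ yφ u yu)

-- This is what makes ¬¬⋁ flat although ⋁ is not: φ need only entail P
-- teamwise and be forced by P at singletons.
neg-expresses : ∀ L {φ : Form} {P : Val → Set} →
                (∀ {X} → X ⊨ φ → ∀ u → X u → P u) → (∀ u → P u → single u ⊨ φ) →
                Expresses (neg L φ) (λ u → ¬ P u)
neg-expresses L φ⇒P P⇒φ .⊨⇒∀ h u xu pu = neg-elim L h u xu (P⇒φ u pu)
neg-expresses L φ⇒P P⇒φ .∀⇒⊨ h = neg-intro L λ Y Y⊆X yφ u yu → h u (Y⊆X u yu) (φ⇒P yφ u yu)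

neg-expresses′ : ∀ L {φ : Form} {P : Val → Set} → Expresses φ P → Expresses (neg L φ) (λ u → ¬ P u)
neg-expresses′ L φ⇔P = neg-expresses L (φ⇔P .⊨⇒∀) (λ u → single-⊨ φ⇔P u .from)

expresses⇒entails : ∀ {θ φ ψ : Form} {R P Q : Val → Set} →
                    Expresses θ R → Expresses φ P → Expresses ψ Q → (∀ u → R u → P u → Q u) →
                    ∀ {Y} → Y ⊨ θ → Y ⊨ φ → Y ⊨ ψ
expresses⇒entails θ⇔R φ⇔P ψ⇔Q R→P→Q yθ yφ =
  ψ⇔Q .∀⇒⊨ λ u yu → R→P→Q u (θ⇔R .⊨⇒∀ yθ u yu) (φ⇔P .⊨⇒∀ yφ u yu)

conj⁻ : ∀ {X} φs → X ⊨ conj φs → All (X ⊨_) φs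
conj⁻ [] _ = []
conj⁻ (φ ∷ []) h = h ∷ []
conj⁻ (φ ∷ ψ ∷ ψs) (h , k) = h ∷ conj⁻ (ψ ∷ ψs) k

conj⁺ : ∀ {X} φs → All (X ⊨_) φs → X ⊨ conj φs
conj⁺ [] [] = lift tt
conj⁺ (φ ∷ []) (h ∷ []) = h
conj⁺ (φ ∷ ψ ∷ ψs) (h ∷ k) = h , conj⁺ (ψ ∷ ψs) k

disj⁻ : ∀ {X} φs → X ⊨ disj φs → Any (X ⊨_) (toList φs)
disj⁻ (φ ∷ []) h = here h
disj⁻ (φ ∷ ψ ∷ ψs) (inj₁ h) = here h
disj⁻ (φ ∷ ψ ∷ ψs) (inj₂ k) = there (disj⁻ (ψ ∷ ψs) k)

disj⁺ : ∀ {X} φs → Any (X ⊨_) (toList φs) → X ⊨ disj φs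
disj⁺ (φ ∷ []) (here h) = h
disj⁺ (φ ∷ ψ ∷ ψs) (here h) = inj₁ h
disj⁺ (φ ∷ ψ ∷ ψs) (there k) = inj₂ (disj⁺ (ψ ∷ ψs) k)

literal : Logic → Form → Bool → Form
literal L φ true = φ
literal L φ false = neg L φ

literal-expresses : ∀ L {φ : Form} {g : Val → Bool} → Expresses φ (λ u → g u ≡ true) →
                    ∀ b → Expresses (literal L φ b) (λ u → g u ≡ b)
literal-expresses L φ⇔g true = φ⇔g
literal-expresses L φ⇔g false = expresses-resp (neg-expresses′ L φ⇔g) (λ u → mk⇔ ¬-not not-¬)

conj-expresses : ∀ {n} (φ : Fin n → Form) (P : Fin n → Val → Set) →
                 (∀ i → Expresses (φ i) (P i)) →
                 Expresses (conj (tabulate φ)) (λ u → ∀ i → P i u)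
conj-expresses φ P φ⇔P .⊨⇒∀ h u xu i = φ⇔P i .⊨⇒∀ (All.tabulate⁻ (conj⁻ _ h) i) u xu
conj-expresses φ P φ⇔P .∀⇒⊨ h = conj⁺ _ (All.tabulate⁺ λ i → φ⇔P i .∀⇒⊨ λ u xu → h u xu i)

subst-var : ∀ φ → subst var φ ≡ φ
substs-var : ∀ φs → substs var φs ≡ φs
subst-var (var p) = refl
subst-var ⊥' = refl
subst-var ⊤' = refl
subst-var (dep φs ψ) = cong₂ dep (substs-var φs) (subst-var ψ)
subst-var (¬' φ) = cong ¬' (subst-var φ)
subst-var (φ ∧' ψ) = cong₂ _∧'_ (subst-var φ) (subst-var ψ)
subst-var (φ ⊗ ψ) = cong₂ _⊗_ (subst-var φ) (subst-var ψ)
subst-var (φ ∨' ψ) = cong₂ _∨'_ (subst-var φ) (subst-var ψ)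
subst-var (φ ⇒ ψ) = cong₂ _⇒_ (subst-var φ) (subst-var ψ)
substs-var [] = refl
substs-var (φ ∷ φs) = cong₂ _∷_ (subst-var φ) (substs-var φs)

subst-neg : ∀ L σ φ → subst σ (neg L φ) ≡ neg L (subst σ φ)
subst-neg InqL σ φ = refl
subst-neg PT σ φ = refl

subst-lit : ∀ L σ p b → subst σ (lit L p b) ≡ literal L (σ p) b
subst-lit L σ p true = refl
subst-lit L σ p false = subst-neg L σ (var p)

subst-conj : ∀ σ φs → subst σ (conj φs) ≡ conj (map (subst σ) φs)
subst-conj σ [] = refl
subst-conj σ (φ ∷ []) = refl
subst-conj σ (φ ∷ ψ ∷ ψs) = cong (subst σ φ ∧'_) (subst-conj σ (ψ ∷ ψs))

subst-disj : ∀ σ φ φs → subst σ (disj (φ ∷ φs)) ≡ disj (List⁺.map (subst σ) (φ ∷ φs))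
subst-disj σ φ [] = refl
subst-disj σ φ (ψ ∷ ψs) = cong (subst σ φ ∨'_) (subst-disj σ ψ ψs)

Matches : ∀ {n} → (Fin n → ℕ) → Val → (Fin n → Bool) → Set
Matches ps u x = ∀ i → u (ps i) ≡ x i

module _ (L : Logic) {n} (ps : Fin n → ℕ) (σ : Subst) (f : Val → Val)
         (σ⇔f : ∀ p → Expresses (σ p) (λ u → f u p ≡ true)) where

  subst-row-expresses : ∀ x → Expresses (subst σ (row L ps x)) (λ u → Matches ps (f u) x)
  subst-row-expresses x =
    subst≡ (λ φ → Expresses φ _) (sym subst-row)
      (conj-expresses _ _ λ i → literal-expresses L (σ⇔f (ps i)) (x i))
    where
    literals : Fin n → Form
    literals i = lit L (ps i) (x i)

    subst-row : subst σ (row L ps x) ≡ conj (tabulate λ i → literal L (σ (ps i)) (x i))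
    subst-row = begin
      subst σ (conj (tabulate literals))
        ≡⟨ subst-conj σ (tabulate literals) ⟩
      conj (map (subst σ) (tabulate literals))
        ≡⟨ cong conj (map-tabulate literals (subst σ)) ⟩
      conj (tabulate (subst σ ∘ literals))
        ≡⟨ cong conj (tabulate-cong λ i → subst-lit L σ (ps i) (x i)) ⟩
      conj (tabulate λ i → literal L (σ (ps i)) (x i)) ∎

  subst-Θ-expresses : ∀ X → Expresses (subst σ (Θ L ps X)) (λ u → ¬ ¬ Any (Matches ps (f u)) (toList X))
  subst-Θ-expresses X@(w ∷ ws) =
    subst≡ (λ φ → Expresses φ _) (sym subst-Θ)
      (neg-expresses′ L (neg-expresses L ⋁⇒matches matches⇒⋁))
    where
    ⋁σrows : Form
    ⋁σrows = disj (List⁺.map (subst σ ∘ row L ps) X)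

    ⋁⇒matches : ∀ {Y} → Y ⊨ ⋁σrows → ∀ u → Y u → Any (Matches ps (f u)) (toList X)
    ⋁⇒matches h u yu =
      Any.map (λ {x} hx → subst-row-expresses x .⊨⇒∀ hx u yu) (Any.map⁻ (disj⁻ _ h))

    matches⇒⋁ : ∀ u → Any (Matches ps (f u)) (toList X) → single u ⊨ ⋁σrows
    matches⇒⋁ u m =
      disj⁺ _ (Any.map⁺ (Any.map (λ {x} → single-⊨ (subst-row-expresses x) u .from) m))

    subst-Θ : subst σ (Θ L ps X) ≡ neg L (neg L ⋁σrows)
    subst-Θ = begin
      subst σ (neg L (neg L (disj (List⁺.map (row L ps) X))))
        ≡⟨ subst-neg L σ _ ⟩
      neg L (subst σ (neg L (disj (List⁺.map (row L ps) X))))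
        ≡⟨ cong (neg L) (subst-neg L σ _) ⟩
      neg L (neg L (subst σ (disj (List⁺.map (row L ps) X))))
        ≡⟨ cong (neg L ∘ neg L) (subst-disj σ (row L ps w) (map (row L ps) ws)) ⟩
      neg L (neg L (disj (List⁺.map (subst σ) (List⁺.map (row L ps) X))))
        ≡⟨ cong (neg L ∘ neg L ∘ disj) (sym (List⁺.map-∘ X)) ⟩
      neg L (neg L ⋁σrows) ∎

matches? : ∀ {n} (ps : Fin n → ℕ) u x → Dec (Matches ps u x)
matches? ps u x = all? λ i → u (ps i) ≟ᵇ x i

Θ-expresses : ∀ L {n} (ps : Fin n → ℕ) X → Expresses (Θ L ps X) (λ u → Any (Matches ps u) (toList X))
Θ-expresses L ps X =
  expresses-resp
    (subst≡ (λ φ → Expresses φ _) (subst-var (Θ L ps X))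
      (subst-Θ-expresses L ps var id var-expresses X))
    (λ u → mk⇔ (decidable-stable (any? (matches? ps u) (toList X))) λ m ¬m → ¬m m)

lang-var : ∀ L p → InLang L (var p)
lang-var InqL p = tt
lang-var PT p = tt

lang-const : ∀ L b → InLang L (const b)
lang-const InqL true = tt
lang-const InqL false = tt
lang-const PT b = tt

lang-neg : ∀ L {φ} → InLang L φ → InLang L (neg L φ)
lang-neg InqL φ∈L = φ∈L , tt
lang-neg PT φ∈L = tt

lang-∧ : ∀ L {φ ψ} → InLang L φ → InLang L ψ → InLang L (φ ∧' ψ)
lang-∧ InqL φ∈L ψ∈L = φ∈L , ψ∈L
lang-∧ PT φ∈L ψ∈L = tt

lang-⇒ : ∀ L {φ ψ} → InLang L φ → InLang L ψ → InLang L (φ ⇒ ψ)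
lang-⇒ InqL φ∈L ψ∈L = φ∈L , ψ∈L
lang-⇒ PT φ∈L ψ∈L = tt

lang-conj : ∀ L {φs} → All (InLang L) φs → InLang L (conj φs)
lang-conj L [] = lang-const L true
lang-conj L (φ∈L ∷ []) = φ∈L
lang-conj L (φ∈L ∷ ψs∈L@(_ ∷ _)) = lang-∧ L φ∈L (lang-conj L ψs∈L)

lang-disj : ∀ L φ φs → All (InLang L) (φ ∷ φs) → InLang L (disj (φ ∷ φs))
lang-disj L φ [] (φ∈L ∷ []) = φ∈L
lang-disj InqL φ (ψ ∷ ψs) (φ∈L ∷ ψs∈L) = φ∈L , lang-disj InqL ψ ψs ψs∈L
lang-disj PT φ (ψ ∷ ψs) _ = tt

lang-subst : ∀ L {σ} → IsSubstOf L σ → ∀ {φ} → InLang L φ → InLang L (subst σ φ)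
lang-subst PT σ∈L φ∈L = tt
lang-subst InqL σ∈L {var p} φ∈L = σ∈L p
lang-subst InqL σ∈L {⊥'} φ∈L = tt
lang-subst InqL σ∈L {⊤'} φ∈L = tt
lang-subst InqL σ∈L {φ ∧' ψ} (φ∈L , ψ∈L) = lang-subst InqL σ∈L φ∈L , lang-subst InqL σ∈L ψ∈L
lang-subst InqL σ∈L {φ ∨' ψ} (φ∈L , ψ∈L) = lang-subst InqL σ∈L φ∈L , lang-subst InqL σ∈L ψ∈L
lang-subst InqL σ∈L {φ ⇒ ψ} (φ∈L , ψ∈L) = lang-subst InqL σ∈L φ∈L , lang-subst InqL σ∈L ψ∈L

lang-row : ∀ L {n} (ps : Fin n → ℕ) x → InLang L (row L ps x)
lang-row L ps x = lang-conj L (All.tabulate⁺ λ i → lang-lit (ps i) (x i))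
  where
  lang-lit : ∀ p b → InLang L (lit L p b)
  lang-lit p true = lang-var L p
  lang-lit p false = lang-neg L (lang-var L p)

lang-Θ : ∀ L {n} (ps : Fin n → ℕ) X → InLang L (Θ L ps X)
lang-Θ L ps (w ∷ ws) =
  lang-neg L (lang-neg L (lang-disj L _ _ (All.map⁺ (universal (lang-row L ps) (w ∷ ws)))))

extend : ∀ {n} → (Fin n → ℕ) → (Fin n → Bool) → Val
extend ps w p with ∃? (λ i → ps i ℕ.≟ p)
... | yes (i , _) = w i
... | no _ = true

extend-matches : ∀ {n} {ps : Fin n → ℕ} → Injective _≡_ _≡_ ps → ∀ w → Matches ps (extend ps w) w
extend-matches {ps = ps} ps-inj w i with ∃? (λ j → ps j ℕ.≟ ps i)
... | yes (j , psj≡psi) = cong w (ps-inj psj≡psi)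
... | no ∄j = ⊥-elim (∄j (i , refl))

module Projection (L : Logic) {n} (ps : Fin n → ℕ) (ps-inj : Injective _≡_ _≡_ ps)
                  (w : Fin n → Bool) (ws : List (Fin n → Bool)) where

  X : List⁺ (Fin n → Bool)
  X = w ∷ ws

  InX : Val → Set
  InX u = Any (Matches ps u) (toList X)

  Θ⇔InX : Expresses (Θ L ps X) InX
  Θ⇔InX = Θ-expresses L ps X

  retract : Val → Val
  retract u with any? (matches? ps u) (toList X)
  ... | yes _ = u
  ... | no _ = extend ps w

  retract-InX : ∀ u → InX (retract u)
  retract-InX u with any? (matches? ps u) (toList X)
  ... | yes u∈X = u∈X
  ... | no _ = here (extend-matches ps-inj w)

  retract-fixes : ∀ u → InX u → ∀ p → retract u p ≡ u p
  retract-fixes u u∈X p with any? (matches? ps u) (toList X)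
  ... | yes _ = refl
  ... | no u∉X = ⊥-elim (u∉X u∈X)

  σ : Subst
  σ p = (Θ L ps X ⇒ var p) ∧' (neg L (Θ L ps X) ⇒ const (extend ps w p))

  σ-expresses : ∀ p → Expresses (σ p) (λ u → retract u p ≡ true)
  σ-expresses p =
    expresses-resp
      (∧-expresses (⇒-expresses Θ⇔InX (var-expresses p))
                   (⇒-expresses (neg-expresses′ L Θ⇔InX) (const-expresses (extend ps w p))))
      by-cases
    where
    by-cases : ∀ u → ((InX u → u p ≡ true) × (¬ InX u → extend ps w p ≡ true)) ⇔ (retract u p ≡ true)
    by-cases u with any? (matches? ps u) (toList X)
    ... | yes u∈X = mk⇔ (λ (h , _) → h u∈X) λ e → (λ _ → e) , (λ u∉X → ⊥-elim (u∉X u∈X))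
    ... | no u∉X = mk⇔ (λ (_ , k) → k u∉X) λ e → (λ u∈X → ⊥-elim (u∉X u∈X)) , (λ _ → e)

  σ-in-L : IsSubstOf L σ
  σ-in-L p = lang-∧ L (lang-⇒ L (lang-Θ L ps X) (lang-var L p))
                      (lang-⇒ L (lang-neg L (lang-Θ L ps X)) (lang-const L (extend ps w p)))

  σΘ-valid : ∀ Y → Y ⊨ subst σ (Θ L ps X)
  σΘ-valid Y =
    subst-Θ-expresses L ps σ retract σ-expresses X .∀⇒⊨ λ u _ ¬u∈X → ¬u∈X (retract-InX u)

lemma4p3 : (L : Logic) (n : ℕ) (ps : Fin n → ℕ) → Injective _≡_ _≡_ ps →
    (X : List⁺ (Fin n → Bool)) → FProjective L (Θ L ps X)
lemma4p3 L n ps ps-inj (w ∷ ws) =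
  σ , σ-in-L , (λ p → expresses⇒flat (σ-expresses p)) ,
  ([] , lang-subst L σ-in-L (lang-Θ L ps X) , λ Y _ → σΘ-valid Y) ,
  (λ p → (lang-Θ L ps X ∷ σ-in-L p ∷ []) , lang-var L p ,
     λ { Y (yΘ ∷ yσp ∷ []) →
           expresses⇒entails Θ⇔InX (σ-expresses p) (var-expresses p)
             (λ u u∈X → trans (sym (retract-fixes u u∈X p))) yΘ yσp }) ,
  (λ p → (lang-Θ L ps X ∷ lang-var L p ∷ []) , σ-in-L p ,
     λ { Y (yΘ ∷ yp ∷ []) →
           expresses⇒entails Θ⇔InX (var-expresses p) (σ-expresses p)
             (λ u u∈X → trans (retract-fixes u u∈X p)) yΘ yp })
  where open Projection L ps ps-inj w ws
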